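{- Let $t$ be a vsub$_k$-term. There is a $\mathsf{vsub}_k$-normalizing derivation $d$ from $t$ if and only if there is a $\mathsf{vseq}$-normalizing derivation $e$ from $t^{\circ}$. Moreover, for such $d$ and $e$, $|d|=|e|$, $|d|_{\mathtt e}=|e|_{\tilde\mu}$ and $|d|_{\mathtt m}=|e|_{\bar\lambda}$.
   Context: Vsub$_k$-terms: $t,u::= v\mid tv\mid t[x\leftarrow u]$, values $v::=x\mid\lambda x.t$, where $t[x\leftarrow u]$ binds $x$ in $t$; $t\{x\leftarrow v\}$ capture-avoiding substitution. Evaluation contexts $E::=\langle\cdot\rangle\mid Ev\mid E[x\leftarrow u]\mid t[x\leftarrow E]$; substitution contexts $L::=\langle\cdot\rangle\mid L[x\leftarrow u]$. $\to_{\mathtt m}$: closure under evaluation contexts of $L\langle\lambda x.t\rangle v\mapsto L\langle t[x\leftarrow v]\rangle$; $\to_{\mathtt e}$: closure of $t[x\leftarrow L\langle v\rangle]\mapsto L\langle t\{x\leftarrow v\}\rangle$ (bound variables of $L$ not free in the other subterm); $\to_{\mathsf{vsub}_k}=\to_{\mathtt m}\cup\to_{\mathtt e}$. Value sequent calculus: commands $c::=\langle v\mid e\rangle$; values $v::=x\mid\lambda x.c$; environments $e::=\epsilon\mid\tilde\mu x.c\mid v\cdot e$ ($\lambda x.c$, $\tilde\mu x.c$ bind $x$). Append: $\langle v\mid e'\rangle@e=\langle v\mid e'@e\rangle$; $\epsilon@e=e$; $(v\cdot e')@e=v\cdot(e'@e)$; $(\tilde\mu x.c)@e=\tilde\mu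 y.(c\{x\leftarrow y\}@e)$, $y$ fresh. Contexts $C::=\langle\cdot\rangle\mid D\langle\tilde\mu x.C\rangle$, $D::=\langle v\mid\langle\cdot\rangle\rangle\mid D\langle v\cdot\langle\cdot\rangle\rangle$. $\to_{\bar\lambda}$, $\to_{\tilde\mu}$: closures under $C$ of $\langle\lambda x.c\mid v\cdot e\rangle\mapsto\langle v\mid(\tilde\mu x.c)@e\rangle$ and $\langle v\mid\tilde\mu x.c\rangle\mapsto c\{x\leftarrow v\}$; $\to_{\mathsf{vseq}}=\to_{\bar\lambda}\cup\to_{\tilde\mu}$. Translation: $x^{\bullet}=x$, $(\lambda x.t)^{\bullet}=\lambda x.t^{\circ}$; $v^{\circ}=\langle v^{\bullet}\mid\epsilon\rangle$, $(tv)^{\circ}=t^{\circ}@(v^{\bullet}\cdot\epsilon)$, $(t[x\leftarrow u])^{\circ}=u^{\circ}@(\tilde\mu x.t^{\circ})$. A derivation is normalizing if it ends in a normal form; $|d|$ is its length and $|d|_{\mathsf r}$ its number of $\mathsf r$-steps. -}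

module Defs where

open import Data.Nat using (ℕ; zero; suc; _+_)
open import Data.Fin using (Fin; zero; suc)
open import Data.Product using (Σ; Σ-syntax; _×_; _,_; ∃)
open import Relation.Nullary using (¬_)
open import Relation.Binary.PropositionalEquality using (_≡_)

-- Well-scoped de Bruijn syntax: a term of type `Tm n` has at most n free
-- variables (Fin n).  α-equivalence is thus syntactic equality.

mutual
  data Val (n : ℕ) : Set where
    var : Fin n → Val n
    lam : Tm (suc n) → Val n

  data Tm (n : ℕ) : Set where
    val : Val n → Tm n
    app : Tm n → Val n → Tm n
    es  : Tm (suc n) → Tm n → Tm n         -- t[x←u]  (x = index 0 in t)

Ren : ℕ → ℕ → Set
Ren n m = Fin n → Fin m

ext : ∀ {n m} → Ren n m → Ren (suc n) (suc m)
ext ρ zero    = zero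
ext ρ (suc i) = suc (ρ i)

mutual
  renV : ∀ {n m} → Ren n m → Val n → Val m
  renV ρ (var i) = var (ρ i)
  renV ρ (lam t) = lam (renT (ext ρ) t)

  renT : ∀ {n m} → Ren n m → Tm n → Tm m
  renT ρ (val v)  = val (renV ρ v)
  renT ρ (app t v) = app (renT ρ t) (renV ρ v)
  renT ρ (es t u) = es (renT (ext ρ) t) (renT ρ u)

Sub : ℕ → ℕ → Set
Sub n m = Fin n → Val m

exts : ∀ {n m} → Sub n m → Sub (suc n) (suc m)
exts σ zero    = var zero
exts σ (suc i) = renV suc (σ i)

mutual
  subV : ∀ {n m} → Sub n m → Val n → Val m
  subV σ (var i) = σ i
  subV σ (lam t) = lam (subT (exts σ) t)

  subT : ∀ {n m} → Sub n m → Tm n → Tm m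
  subT σ (val v)   = val (subV σ v)
  subT σ (app t v) = app (subT σ t) (subV σ v)
  subT σ (es t u)  = es (subT (exts σ) t) (subT σ u)

single : ∀ {n} → Val n → Sub (suc n) n
single v zero    = v
single v (suc i) = var i

_⟨0≔_⟩ : ∀ {n} → Tm (suc n) → Val n → Tm n
t ⟨0≔ v ⟩ = subT (single v) t

-- Substitution contexts L ::= ⟨·⟩ | L[x←u].
-- `SCtx n m`: the whole context lives in scope n, the hole in scope m.
data SCtx (n : ℕ) : ℕ → Set where
  hole : SCtx n n
  esc  : ∀ {m} → SCtx (suc n) m → Tm n → SCtx n m

plugL : ∀ {n m} → SCtx n m → Tm m → Tm n
plugL hole      t = t
plugL (esc L u) t = es (plugL L t) u

-- weakening past the binders of L
wkL : ∀ {n m} → SCtx n m → Ren n m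
wkL hole      i = i
wkL (esc L u) i = wkL L (suc i)

data VKind : Set where
  m-step e-step : VKind

-- root rules and closure under evaluation contexts
-- E ::= ⟨·⟩ | E v | E[x←u] | t[x←E]
data _⊢_⟶v_ {n : ℕ} : VKind → Tm n → Tm n → Set where
  root-m : ∀ {m} (L : SCtx n m) (t : Tm (suc m)) (v : Val n) →
           m-step ⊢ app (plugL L (val (lam t))) v ⟶v plugL L (es t (val (renV (wkL L) v)))
  root-e : ∀ {m} (t : Tm (suc n)) (L : SCtx n m) (v : Val m) →
           e-step ⊢ es t (plugL L (val v)) ⟶v plugL L (renT (ext (wkL L)) t ⟨0≔ v ⟩)
  ctx-app : ∀ {k t t'} (v : Val n) → k ⊢ t ⟶v t' → k ⊢ app t v ⟶v app t' v
  ctx-esl : ∀ {k t t'} (u : Tm n) → _⊢_⟶v_ {suc n} k t t' → k ⊢ es t u ⟶v es t' u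
  ctx-esr : ∀ {k u u'} (t : Tm (suc n)) → k ⊢ u ⟶v u' → k ⊢ es t u ⟶v es t u'

mutual
  data Cmd (n : ℕ) : Set where
    cut : SVal n → Env n → Cmd n

  data SVal (n : ℕ) : Set where
    svar : Fin n → SVal n
    slam : Cmd (suc n) → SVal n

  data Env (n : ℕ) : Set where
    ε    : Env n
    mut  : Cmd (suc n) → Env n
    push : SVal n → Env n → Env n

mutual
  renC : ∀ {n m} → Ren n m → Cmd n → Cmd m
  renC ρ (cut v e) = cut (renSV ρ v) (renE ρ e)

  renSV : ∀ {n m} → Ren n m → SVal n → SVal m
  renSV ρ (svar i) = svar (ρ i)
  renSV ρ (slam c) = slam (renC (ext ρ) c)

  renE : ∀ {n m} → Ren n m → Env n → Env m
  renE ρ ε          = ε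
  renE ρ (mut c)    = mut (renC (ext ρ) c)
  renE ρ (push v e) = push (renSV ρ v) (renE ρ e)

SSub : ℕ → ℕ → Set
SSub n m = Fin n → SVal m

sexts : ∀ {n m} → SSub n m → SSub (suc n) (suc m)
sexts σ zero    = svar zero
sexts σ (suc i) = renSV suc (σ i)

mutual
  subC : ∀ {n m} → SSub n m → Cmd n → Cmd m
  subC σ (cut v e) = cut (subSV σ v) (subE σ e)

  subSV : ∀ {n m} → SSub n m → SVal n → SVal m
  subSV σ (svar i) = σ i
  subSV σ (slam c) = slam (subC (sexts σ) c)

  subE : ∀ {n m} → SSub n m → Env n → Env m
  subE σ ε          = ε
  subE σ (mut c)    = mut (subC (sexts σ) c)
  subE σ (push v e) = push (subSV σ v) (subE σ e)

ssingle : ∀ {n} → SVal n → SSub (suc n) n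
ssingle v zero    = v
ssingle v (suc i) = svar i

mutual
  _++c_ : ∀ {n} → Cmd n → Env n → Cmd n
  cut v e' ++c e = cut v (e' ++e e)

  _++e_ : ∀ {n} → Env n → Env n → Env n
  ε          ++e e = e
  push v e'  ++e e = push v (e' ++e e)
  mut c      ++e e = mut (c ++c renE suc e)    -- (μ̃x.c)@e = μ̃y.(c{x←y}@e), y fresh

data SKind : Set where
  λ̄-step μ̃-step : SKind

-- root rules and closure under C ::= ⟨·⟩ | D⟨μ̃x.C⟩, D ::= ⟨v|⟨·⟩⟩ | D⟨v·⟨·⟩⟩
mutual
  data _⊢_⟶s_ {n : ℕ} : SKind → Cmd n → Cmd n → Set where
    root-λ̄ : (c : Cmd (suc n)) (v : SVal n) (e : Env n) →
             λ̄-step ⊢ cut (slam c) (push v e) ⟶s cut v (mut c ++e e)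
    root-μ̃ : (v : SVal n) (c : Cmd (suc n)) →
             μ̃-step ⊢ cut v (mut c) ⟶s subC (ssingle v) c
    ctx-cut : ∀ {k e e'} (v : SVal n) → k ⊢ e ⟶se e' → k ⊢ cut v e ⟶s cut v e'

  data _⊢_⟶se_ {n : ℕ} : SKind → Env n → Env n → Set where
    ctx-push : ∀ {k e e'} (v : SVal n) → k ⊢ e ⟶se e' → k ⊢ push v e ⟶se push v e'
    ctx-mut  : ∀ {k c c'} → _⊢_⟶s_ {suc n} k c c' → k ⊢ mut c ⟶se mut c'

mutual
  _• : ∀ {n} → Val n → SVal n
  var x • = svar x
  lam t • = slam (t °)

  _° : ∀ {n} → Tm n → Cmd n
  val v °   = cut (v •) ε
  app t v ° = (t °) ++c push (v •) ε
  es t u °  = (u °) ++c mut (t °)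

module _ {A K : Set} (R : K → A → A → Set) where

  data Deriv : A → A → Set where
    done : ∀ {a} → Deriv a a
    step : ∀ {a b c} (k : K) → R k a b → Deriv b c → Deriv a c

  Normal : A → Set
  Normal a = ¬ (Σ[ k ∈ K ] Σ[ b ∈ A ] R k a b)

  NormDeriv : A → Set
  NormDeriv a = Σ[ b ∈ A ] (Deriv a b × Normal b)

module _ {A K : Set} {R : K → A → A → Set} where

  len : ∀ {a b} → Deriv R a b → ℕ
  len done           = 0
  len (step k r d)   = suc (len d)

  countBy : (K → ℕ) → ∀ {a b} → Deriv R a b → ℕ
  countBy w done         = 0
  countBy w (step k r d) = w k + countBy w d

  ndLen : ∀ {a} → NormDeriv R a → ℕ
  ndLen (_ , d , _) = len d

  ndCount : (K → ℕ) → ∀ {a} → NormDeriv R a → ℕ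
  ndCount w (_ , d , _) = countBy w d

VStep : ∀ {n} → VKind → Tm n → Tm n → Set
VStep k t u = k ⊢ t ⟶v u

SStep : ∀ {n} → SKind → Cmd n → Cmd n → Set
SStep k c c' = k ⊢ c ⟶s c'

isM isE : VKind → ℕ
isM m-step = 1
isM e-step = 0
isE m-step = 0
isE e-step = 1

isλ̄ isμ̃ : SKind → ℕ
isλ̄ λ̄-step = 1
isλ̄ μ̃-step = 0
isμ̃ λ̄-step = 0
isμ̃ μ̃-step = 1

module Submission where

-- The proof rests on three facts about the translation.
--   (1) Strict simulation: every vsub_k step t → u of kind m (resp. e) is
--       mapped to exactly one vseq step t° → u° of kind λ̄ (resp. μ̃).
--   (2) Normal forms are preserved: t normal implies t° normal.  This uses a
--       syntactic description of normal forms on both sides, and progress for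
--       vsub_k (a term is either normal or reduces).
--   (3) vseq has the one-step diamond property, hence all normalising
--       derivations from a command have the same length and step counts.
-- The module `Simulation` shows abstractly that (1)-(3) imply the theorem:
-- derivations are transported forward; backwards, a non-normal t makes a step
-- whose image can, by the diamond property, be moved to the front of any given
-- normalising derivation of t°, and we recurse on the (shorter) residual.

open import Defs
open import Data.Nat using (ℕ; zero; suc; _+_)
open import Data.Nat.Properties using (+-commutativeSemigroup; suc-injective)
open import Algebra.Properties.CommutativeSemigroup +-commutativeSemigroup using (x∙yz≈y∙xz)
open import Data.Fin using (Fin; zero; suc)
open import Data.Product using (Σ-syntax; _×_; _,_)
open import Data.Sum using (_⊎_; inj₁; inj₂)
open import Data.Empty using (⊥; ⊥-elim)
open import Data.Unit using (⊤; tt)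
open import Function using (case_of_)
open import Relation.Binary.PropositionalEquality
  using (_≡_; _≗_; refl; sym; trans; cong; cong₂; subst₂; module ≡-Reasoning)

Diamond : {A K : Set} → (K → A → A → Set) → Set
Diamond {A} R = ∀ {a b c k₁ k₂} → R k₁ a b → R k₂ a c →
  (k₁ ≡ k₂ × b ≡ c) ⊎ Σ[ d ∈ A ] (R k₂ b d × R k₁ c d)

module DiamondProperties {A K : Set} {R : K → A → A → Set} (diamond : Diamond R) where

  residual : ∀ {a z k c} (d : Deriv R a z) → Normal R z → R k a c →
    Σ[ d' ∈ Deriv R c z ] (len d ≡ suc (len d') × (∀ w → countBy w d ≡ w k + countBy w d'))
  residual done z-normal r = ⊥-elim (z-normal (_ , _ , r))
  residual {k = k} (step k₁ r₁ d) z-normal r with diamond r₁ r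
  ... | inj₁ (refl , refl) = d , refl , λ w → refl
  ... | inj₂ (_ , r-b , r-c) with residual d z-normal r-b
  ...   | d' , len-eq , count-eq =
          step k₁ r-c d' , cong suc len-eq ,
          λ w → trans (cong (w k₁ +_) (count-eq w)) (x∙yz≈y∙xz (w k₁) (w k) (countBy w d'))

  unique : ∀ {a z₁ z₂} (d₁ : Deriv R a z₁) → Normal R z₁ → (d₂ : Deriv R a z₂) → Normal R z₂ →
    len d₁ ≡ len d₂ × (∀ w → countBy w d₁ ≡ countBy w d₂)
  unique done _ done _ = refl , λ w → refl
  unique (step k r d₁) _ done z₂-normal = ⊥-elim (z₂-normal (_ , _ , r))
  unique d₁ z₁-normal (step k r d₂) z₂-normal with residual d₁ z₁-normal r
  ... | d₁' , len-eq , count-eq with unique d₁' z₁-normal d₂ z₂-normal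
  ...   | len-eq' , count-eq' =
          trans len-eq (cong suc len-eq') , λ w → trans (count-eq w) (cong (w k +_) (count-eq' w))

module Simulation {A B VK SK : Set} {R : VK → A → A → Set} {S : SK → B → B → Set}
  (f : A → B) (κ : VK → SK)
  (simulate : ∀ {k a a'} → R k a a' → S (κ k) (f a) (f a'))
  (preserve-normal : ∀ {a} → Normal R a → Normal S (f a))
  (progress : ∀ a → Normal R a ⊎ Σ[ k ∈ VK ] Σ[ a' ∈ A ] R k a a')
  (diamond : Diamond S) where

  open DiamondProperties diamond

  mapDeriv : ∀ {a a'} → Deriv R a a' → Deriv S (f a) (f a')
  mapDeriv done         = done
  mapDeriv (step k r d) = step (κ k) (simulate r) (mapDeriv d)

  len-map : ∀ {a a'} (d : Deriv R a a') → len (mapDeriv d) ≡ len d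
  len-map done         = refl
  len-map (step k r d) = cong suc (len-map d)

  count-map : (w : VK → ℕ) (w' : SK → ℕ) → (∀ k → w k ≡ w' (κ k)) →
    ∀ {a a'} (d : Deriv R a a') → countBy w d ≡ countBy w' (mapDeriv d)
  count-map w w' w≡w'∘κ done         = refl
  count-map w w' w≡w'∘κ (step k r d) = cong₂ _+_ (w≡w'∘κ k) (count-map w w' w≡w'∘κ d)

  forward : ∀ {a} → NormDeriv R a → NormDeriv S (f a)
  forward (b , d , b-normal) = f b , mapDeriv d , preserve-normal b-normal

  backward-by : (N : ℕ) → ∀ a {z} (e : Deriv S (f a) z) → len e ≡ N → Normal S z → NormDeriv R a
  backward-by N a e len-e z-normal with progress a
  ... | inj₁ a-normal = a , done , a-normal
  ... | inj₂ (k , a' , r) with residual e z-normal (simulate r) | N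
  ...   | e' , len-eq , _ | zero = case trans (sym len-eq) len-e of λ ()
  ...   | e' , len-eq , _ | suc N' with backward-by N' a' e' (suc-injective (trans (sym len-eq) len-e)) z-normal
  ...     | b , d , b-normal = b , step k r d , b-normal

  backward : ∀ {a} → NormDeriv S (f a) → NormDeriv R a
  backward {a} (z , e , z-normal) = backward-by (len e) a e refl z-normal

  -- The transported derivation is normalising, so by uniqueness in the
  -- target it has the length and counts of any other one.
  same-measures : ∀ {a} (d : NormDeriv R a) (e : NormDeriv S (f a)) →
    ndLen d ≡ ndLen e ×
    (∀ w w' → (∀ k → w k ≡ w' (κ k)) → ndCount w d ≡ ndCount w' e)
  same-measures (b , d , b-normal) (z , e , z-normal)
    with unique (mapDeriv d) (preserve-normal b-normal) e z-normal
  ... | len-eq , count-eq =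
        trans (sym (len-map d)) len-eq ,
        λ w w' w≡w'∘κ → trans (count-map w w' w≡w'∘κ d) (count-eq w')

ext-cong : ∀ {n m} {ρ ρ' : Ren n m} → ρ ≗ ρ' → ext ρ ≗ ext ρ'
ext-cong h zero    = refl
ext-cong h (suc i) = cong suc (h i)

ext-comp : ∀ {n m k} (ρ : Ren m k) (ρ' : Ren n m) → (λ i → ext ρ (ext ρ' i)) ≗ ext (λ j → ρ (ρ' j))
ext-comp ρ ρ' zero    = refl
ext-comp ρ ρ' (suc i) = refl

ext-id : ∀ {n} {ρ : Ren n n} → (∀ i → ρ i ≡ i) → ∀ i → ext ρ i ≡ i
ext-id h zero    = refl
ext-id h (suc i) = cong suc (h i)

mutual
  renC-cong : ∀ {n m} {ρ ρ' : Ren n m} → ρ ≗ ρ' → renC ρ ≗ renC ρ'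
  renC-cong h (cut v e) = cong₂ cut (renSV-cong h v) (renE-cong h e)

  renSV-cong : ∀ {n m} {ρ ρ' : Ren n m} → ρ ≗ ρ' → renSV ρ ≗ renSV ρ'
  renSV-cong h (svar i) = cong svar (h i)
  renSV-cong h (slam c) = cong slam (renC-cong (ext-cong h) c)

  renE-cong : ∀ {n m} {ρ ρ' : Ren n m} → ρ ≗ ρ' → renE ρ ≗ renE ρ'
  renE-cong h ε          = refl
  renE-cong h (mut c)    = cong mut (renC-cong (ext-cong h) c)
  renE-cong h (push v e) = cong₂ push (renSV-cong h v) (renE-cong h e)

mutual
  renC-renC : ∀ {n m k} (ρ : Ren m k) (ρ' : Ren n m) c → renC ρ (renC ρ' c) ≡ renC (λ i → ρ (ρ' i)) c
  renC-renC ρ ρ' (cut v e) = cong₂ cut (renSV-renSV ρ ρ' v) (renE-renE ρ ρ' e)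

  renSV-renSV : ∀ {n m k} (ρ : Ren m k) (ρ' : Ren n m) v → renSV ρ (renSV ρ' v) ≡ renSV (λ i → ρ (ρ' i)) v
  renSV-renSV ρ ρ' (svar i) = refl
  renSV-renSV ρ ρ' (slam c) = cong slam (trans (renC-renC (ext ρ) (ext ρ') c) (renC-cong (ext-comp ρ ρ') c))

  renE-renE : ∀ {n m k} (ρ : Ren m k) (ρ' : Ren n m) e → renE ρ (renE ρ' e) ≡ renE (λ i → ρ (ρ' i)) e
  renE-renE ρ ρ' ε          = refl
  renE-renE ρ ρ' (mut c)    = cong mut (trans (renC-renC (ext ρ) (ext ρ') c) (renC-cong (ext-comp ρ ρ') c))
  renE-renE ρ ρ' (push v e) = cong₂ push (renSV-renSV ρ ρ' v) (renE-renE ρ ρ' e)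

renE-ext-suc : ∀ {n m} (ρ : Ren n m) e → renE (ext ρ) (renE suc e) ≡ renE suc (renE ρ e)
renE-ext-suc ρ e = trans (renE-renE (ext ρ) suc e) (sym (renE-renE suc ρ e))

sexts-cong : ∀ {n m} {σ τ : SSub n m} → σ ≗ τ → sexts σ ≗ sexts τ
sexts-cong h zero    = refl
sexts-cong h (suc i) = cong (renSV suc) (h i)

mutual
  subC-cong : ∀ {n m} {σ τ : SSub n m} → σ ≗ τ → subC σ ≗ subC τ
  subC-cong h (cut v e) = cong₂ cut (subSV-cong h v) (subE-cong h e)

  subSV-cong : ∀ {n m} {σ τ : SSub n m} → σ ≗ τ → subSV σ ≗ subSV τ
  subSV-cong h (svar i) = h i
  subSV-cong h (slam c) = cong slam (subC-cong (sexts-cong h) c)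

  subE-cong : ∀ {n m} {σ τ : SSub n m} → σ ≗ τ → subE σ ≗ subE τ
  subE-cong h ε          = refl
  subE-cong h (mut c)    = cong mut (subC-cong (sexts-cong h) c)
  subE-cong h (push v e) = cong₂ push (subSV-cong h v) (subE-cong h e)

sexts-ext : ∀ {n m k} (σ : SSub m k) (ρ : Ren n m) → (λ i → sexts σ (ext ρ i)) ≗ sexts (λ j → σ (ρ j))
sexts-ext σ ρ zero    = refl
sexts-ext σ ρ (suc i) = refl

mutual
  subC-renC : ∀ {n m k} (σ : SSub m k) (ρ : Ren n m) c → subC σ (renC ρ c) ≡ subC (λ i → σ (ρ i)) c
  subC-renC σ ρ (cut v e) = cong₂ cut (subSV-renSV σ ρ v) (subE-renE σ ρ e)

  subSV-renSV : ∀ {n m k} (σ : SSub m k) (ρ : Ren n m) v → subSV σ (renSV ρ v) ≡ subSV (λ i → σ (ρ i)) v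
  subSV-renSV σ ρ (svar i) = refl
  subSV-renSV σ ρ (slam c) = cong slam (trans (subC-renC (sexts σ) (ext ρ) c) (subC-cong (sexts-ext σ ρ) c))

  subE-renE : ∀ {n m k} (σ : SSub m k) (ρ : Ren n m) e → subE σ (renE ρ e) ≡ subE (λ i → σ (ρ i)) e
  subE-renE σ ρ ε          = refl
  subE-renE σ ρ (mut c)    = cong mut (trans (subC-renC (sexts σ) (ext ρ) c) (subC-cong (sexts-ext σ ρ) c))
  subE-renE σ ρ (push v e) = cong₂ push (subSV-renSV σ ρ v) (subE-renE σ ρ e)

ext-sexts : ∀ {n m k} (ρ : Ren m k) (σ : SSub n m) → (λ i → renSV (ext ρ) (sexts σ i)) ≗ sexts (λ j → renSV ρ (σ j))
ext-sexts ρ σ zero    = refl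
ext-sexts ρ σ (suc i) = trans (renSV-renSV (ext ρ) suc (σ i)) (sym (renSV-renSV suc ρ (σ i)))

mutual
  renC-subC : ∀ {n m k} (ρ : Ren m k) (σ : SSub n m) c → renC ρ (subC σ c) ≡ subC (λ i → renSV ρ (σ i)) c
  renC-subC ρ σ (cut v e) = cong₂ cut (renSV-subSV ρ σ v) (renE-subE ρ σ e)

  renSV-subSV : ∀ {n m k} (ρ : Ren m k) (σ : SSub n m) v → renSV ρ (subSV σ v) ≡ subSV (λ i → renSV ρ (σ i)) v
  renSV-subSV ρ σ (svar i) = refl
  renSV-subSV ρ σ (slam c) = cong slam (trans (renC-subC (ext ρ) (sexts σ) c) (subC-cong (ext-sexts ρ σ) c))

  renE-subE : ∀ {n m k} (ρ : Ren m k) (σ : SSub n m) e → renE ρ (subE σ e) ≡ subE (λ i → renSV ρ (σ i)) e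
  renE-subE ρ σ ε          = refl
  renE-subE ρ σ (mut c)    = cong mut (trans (renC-subC (ext ρ) (sexts σ) c) (subC-cong (ext-sexts ρ σ) c))
  renE-subE ρ σ (push v e) = cong₂ push (renSV-subSV ρ σ v) (renE-subE ρ σ e)

subE-sexts-suc : ∀ {n m} (σ : SSub n m) e → subE (sexts σ) (renE suc e) ≡ renE suc (subE σ e)
subE-sexts-suc σ e = trans (subE-renE (sexts σ) suc e) (sym (renE-subE suc σ e))

sexts-sexts : ∀ {n m k} (σ : SSub m k) (τ : SSub n m) → (λ i → subSV (sexts σ) (sexts τ i)) ≗ sexts (λ j → subSV σ (τ j))
sexts-sexts σ τ zero    = refl
sexts-sexts σ τ (suc i) = trans (subSV-renSV (sexts σ) suc (τ i)) (sym (renSV-subSV suc σ (τ i)))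

mutual
  subC-subC : ∀ {n m k} (σ : SSub m k) (τ : SSub n m) c → subC σ (subC τ c) ≡ subC (λ i → subSV σ (τ i)) c
  subC-subC σ τ (cut v e) = cong₂ cut (subSV-subSV σ τ v) (subE-subE σ τ e)

  subSV-subSV : ∀ {n m k} (σ : SSub m k) (τ : SSub n m) v → subSV σ (subSV τ v) ≡ subSV (λ i → subSV σ (τ i)) v
  subSV-subSV σ τ (svar i) = refl
  subSV-subSV σ τ (slam c) = cong slam (trans (subC-subC (sexts σ) (sexts τ) c) (subC-cong (sexts-sexts σ τ) c))

  subE-subE : ∀ {n m k} (σ : SSub m k) (τ : SSub n m) e → subE σ (subE τ e) ≡ subE (λ i → subSV σ (τ i)) e
  subE-subE σ τ ε          = refl
  subE-subE σ τ (mut c)    = cong mut (trans (subC-subC (sexts σ) (sexts τ) c) (subC-cong (sexts-sexts σ τ) c))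
  subE-subE σ τ (push v e) = cong₂ push (subSV-subSV σ τ v) (subE-subE σ τ e)

sexts-id : ∀ {n} {σ : SSub n n} → σ ≗ svar → sexts σ ≗ svar
sexts-id h zero    = refl
sexts-id h (suc i) = cong (renSV suc) (h i)

mutual
  subC-id : ∀ {n} {σ : SSub n n} → σ ≗ svar → ∀ c → subC σ c ≡ c
  subC-id h (cut v e) = cong₂ cut (subSV-id h v) (subE-id h e)

  subSV-id : ∀ {n} {σ : SSub n n} → σ ≗ svar → ∀ v → subSV σ v ≡ v
  subSV-id h (svar i) = h i
  subSV-id h (slam c) = cong slam (subC-id (sexts-id h) c)

  subE-id : ∀ {n} {σ : SSub n n} → σ ≗ svar → ∀ e → subE σ e ≡ e
  subE-id h ε          = refl
  subE-id h (mut c)    = cong mut (subC-id (sexts-id h) c)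
  subE-id h (push v e) = cong₂ push (subSV-id h v) (subE-id h e)

sexts-ren : ∀ {n m} (ρ : Ren n m) → sexts (λ j → svar (ρ j)) ≗ (λ i → svar (ext ρ i))
sexts-ren ρ zero    = refl
sexts-ren ρ (suc i) = refl

mutual
  renC-as-sub : ∀ {n m} (ρ : Ren n m) c → renC ρ c ≡ subC (λ i → svar (ρ i)) c
  renC-as-sub ρ (cut v e) = cong₂ cut (renSV-as-sub ρ v) (renE-as-sub ρ e)

  renSV-as-sub : ∀ {n m} (ρ : Ren n m) v → renSV ρ v ≡ subSV (λ i → svar (ρ i)) v
  renSV-as-sub ρ (svar i) = refl
  renSV-as-sub ρ (slam c) = cong slam (trans (renC-as-sub (ext ρ) c) (sym (subC-cong (sexts-ren ρ) c)))

  renE-as-sub : ∀ {n m} (ρ : Ren n m) e → renE ρ e ≡ subE (λ i → svar (ρ i)) e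
  renE-as-sub ρ ε          = refl
  renE-as-sub ρ (mut c)    = cong mut (trans (renC-as-sub (ext ρ) c) (sym (subC-cong (sexts-ren ρ) c)))
  renE-as-sub ρ (push v e) = cong₂ push (renSV-as-sub ρ v) (renE-as-sub ρ e)

subC-single : ∀ {n m} (σ : SSub n m) v c →
  subC σ (subC (ssingle v) c) ≡ subC (ssingle (subSV σ v)) (subC (sexts σ) c)
subC-single σ v c =
  trans (subC-subC σ (ssingle v) c)
    (trans (subC-cong pointwise c) (sym (subC-subC (ssingle (subSV σ v)) (sexts σ) c)))
  where
  pointwise : ∀ i → subSV σ (ssingle v i) ≡ subSV (ssingle (subSV σ v)) (sexts σ i)
  pointwise zero    = refl
  pointwise (suc i) = sym (trans (subSV-renSV (ssingle (subSV σ v)) suc (σ i)) (subSV-id (λ _ → refl) (σ i)))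

mutual
  renC-++ : ∀ {n m} (ρ : Ren n m) c e → renC ρ (c ++c e) ≡ renC ρ c ++c renE ρ e
  renC-++ ρ (cut v e') e = cong (cut (renSV ρ v)) (renE-++ ρ e' e)

  renE-++ : ∀ {n m} (ρ : Ren n m) e₁ e₂ → renE ρ (e₁ ++e e₂) ≡ renE ρ e₁ ++e renE ρ e₂
  renE-++ ρ ε           e₂ = refl
  renE-++ ρ (push v e₁) e₂ = cong (push (renSV ρ v)) (renE-++ ρ e₁ e₂)
  renE-++ ρ (mut c)     e₂ =
    cong mut (trans (renC-++ (ext ρ) c (renE suc e₂)) (cong (renC (ext ρ) c ++c_) (renE-ext-suc ρ e₂)))

mutual
  subC-++ : ∀ {n m} (σ : SSub n m) c e → subC σ (c ++c e) ≡ subC σ c ++c subE σ e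
  subC-++ σ (cut v e') e = cong (cut (subSV σ v)) (subE-++ σ e' e)

  subE-++ : ∀ {n m} (σ : SSub n m) e₁ e₂ → subE σ (e₁ ++e e₂) ≡ subE σ e₁ ++e subE σ e₂
  subE-++ σ ε           e₂ = refl
  subE-++ σ (push v e₁) e₂ = cong (push (subSV σ v)) (subE-++ σ e₁ e₂)
  subE-++ σ (mut c)     e₂ =
    cong mut (trans (subC-++ (sexts σ) c (renE suc e₂)) (cong (subC (sexts σ) c ++c_) (subE-sexts-suc σ e₂)))

mutual
  ++c-assoc : ∀ {n} (c : Cmd n) e₁ e₂ → (c ++c e₁) ++c e₂ ≡ c ++c (e₁ ++e e₂)
  ++c-assoc (cut v e) e₁ e₂ = cong (cut v) (++e-assoc e e₁ e₂)

  ++e-assoc : ∀ {n} (e₀ e₁ e₂ : Env n) → (e₀ ++e e₁) ++e e₂ ≡ e₀ ++e (e₁ ++e e₂)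
  ++e-assoc ε           e₁ e₂ = refl
  ++e-assoc (push v e₀) e₁ e₂ = cong (push v) (++e-assoc e₀ e₁ e₂)
  ++e-assoc (mut c)     e₁ e₂ =
    cong mut (trans (++c-assoc c (renE suc e₁) (renE suc e₂)) (cong (c ++c_) (sym (renE-++ suc e₁ e₂))))

mutual
  ++c-ε : ∀ {n} (c : Cmd n) → c ++c ε ≡ c
  ++c-ε (cut v e) = cong (cut v) (++e-ε e)

  ++e-ε : ∀ {n} (e : Env n) → e ++e ε ≡ e
  ++e-ε ε          = refl
  ++e-ε (push v e) = cong (push v) (++e-ε e)
  ++e-ε (mut c)    = cong mut (++c-ε c)

mutual
  renT-cong : ∀ {n m} {ρ ρ' : Ren n m} → ρ ≗ ρ' → renT ρ ≗ renT ρ'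
  renT-cong h (val v)   = cong val (renV-cong h v)
  renT-cong h (app t v) = cong₂ app (renT-cong h t) (renV-cong h v)
  renT-cong h (es t u)  = cong₂ es (renT-cong (ext-cong h) t) (renT-cong h u)

  renV-cong : ∀ {n m} {ρ ρ' : Ren n m} → ρ ≗ ρ' → renV ρ ≗ renV ρ'
  renV-cong h (var i) = cong var (h i)
  renV-cong h (lam t) = cong lam (renT-cong (ext-cong h) t)

mutual
  renT-renT : ∀ {n m k} (ρ : Ren m k) (ρ' : Ren n m) t → renT ρ (renT ρ' t) ≡ renT (λ i → ρ (ρ' i)) t
  renT-renT ρ ρ' (val v)   = cong val (renV-renV ρ ρ' v)
  renT-renT ρ ρ' (app t v) = cong₂ app (renT-renT ρ ρ' t) (renV-renV ρ ρ' v)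
  renT-renT ρ ρ' (es t u)  =
    cong₂ es (trans (renT-renT (ext ρ) (ext ρ') t) (renT-cong (ext-comp ρ ρ') t)) (renT-renT ρ ρ' u)

  renV-renV : ∀ {n m k} (ρ : Ren m k) (ρ' : Ren n m) v → renV ρ (renV ρ' v) ≡ renV (λ i → ρ (ρ' i)) v
  renV-renV ρ ρ' (var i) = refl
  renV-renV ρ ρ' (lam t) = cong lam (trans (renT-renT (ext ρ) (ext ρ') t) (renT-cong (ext-comp ρ ρ') t))

mutual
  renT-id : ∀ {n} {ρ : Ren n n} → (∀ i → ρ i ≡ i) → ∀ t → renT ρ t ≡ t
  renT-id h (val v)   = cong val (renV-id h v)
  renT-id h (app t v) = cong₂ app (renT-id h t) (renV-id h v)
  renT-id h (es t u)  = cong₂ es (renT-id (ext-id h) t) (renT-id h u)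

  renV-id : ∀ {n} {ρ : Ren n n} → (∀ i → ρ i ≡ i) → ∀ v → renV ρ v ≡ v
  renV-id h (var i) = cong var (h i)
  renV-id h (lam t) = cong lam (renT-id (ext-id h) t)

-- The translation with an accumulating environment: t °[ e ] = t° @ e.
-- Appends are then fused away, which makes the translation commute with
-- renaming, substitution and reduction in the environment.
infix 25 _°[_]
_°[_] : ∀ {n} → Tm n → Env n → Cmd n
val v   °[ e ] = cut (v •) e
app t v °[ e ] = t °[ push (v •) e ]
es t u  °[ e ] = u °[ mut (t °[ renE suc e ]) ]

°-++ : ∀ {n} (t : Tm n) e → (t °) ++c e ≡ t °[ e ]
°-++ (val v)   e = refl
°-++ (app t v) e = trans (++c-assoc (t °) (push (v •) ε) e) (°-++ t (push (v •) e))
°-++ (es t u)  e = begin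
  ((u °) ++c mut (t °)) ++c e                  ≡⟨ ++c-assoc (u °) (mut (t °)) e ⟩
  (u °) ++c mut ((t °) ++c renE suc e)         ≡⟨ cong (λ c → (u °) ++c mut c) (°-++ t (renE suc e)) ⟩
  (u °) ++c mut (t °[ renE suc e ])            ≡⟨ °-++ u _ ⟩
  u °[ mut (t °[ renE suc e ]) ]               ∎
  where open ≡-Reasoning

°-as-acc : ∀ {n} (t : Tm n) → t ° ≡ t °[ ε ]
°-as-acc t = trans (sym (++c-ε (t °))) (°-++ t ε)

mutual
  renC-°[] : ∀ {n m} (ρ : Ren n m) t e → renC ρ (t °[ e ]) ≡ renT ρ t °[ renE ρ e ]
  renC-°[] ρ (val v)   e = cong (λ w → cut w (renE ρ e)) (renSV-• ρ v)
  renC-°[] ρ (app t v) e =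
    trans (renC-°[] ρ t (push (v •) e)) (cong (λ w → renT ρ t °[ push w (renE ρ e) ]) (renSV-• ρ v))
  renC-°[] ρ (es t u)  e = trans (renC-°[] ρ u _) (cong (λ c → renT ρ u °[ mut c ])
    (trans (renC-°[] (ext ρ) t (renE suc e)) (cong (renT (ext ρ) t °[_]) (renE-ext-suc ρ e))))

  renSV-• : ∀ {n m} (ρ : Ren n m) v → renSV ρ (v •) ≡ renV ρ v •
  renSV-• ρ (var i) = refl
  renSV-• ρ (lam t) = cong slam (begin
    renC (ext ρ) (t °)                 ≡⟨ cong (renC (ext ρ)) (°-as-acc t) ⟩
    renC (ext ρ) (t °[ ε ])            ≡⟨ renC-°[] (ext ρ) t ε ⟩
    renT (ext ρ) t °[ ε ]              ≡⟨ sym (°-as-acc (renT (ext ρ) t)) ⟩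
    renT (ext ρ) t °                   ∎)
    where open ≡-Reasoning

_•ˢ : ∀ {n m} → Sub n m → SSub n m
(σ •ˢ) i = σ i •

sexts-• : ∀ {n m} (σ : Sub n m) → sexts (σ •ˢ) ≗ (exts σ •ˢ)
sexts-• σ zero    = refl
sexts-• σ (suc i) = renSV-• suc (σ i)

mutual
  subC-°[] : ∀ {n m} (σ : Sub n m) t e → subC (σ •ˢ) (t °[ e ]) ≡ subT σ t °[ subE (σ •ˢ) e ]
  subC-°[] σ (val v)   e = cong (λ w → cut w (subE (σ •ˢ) e)) (subSV-• σ v)
  subC-°[] σ (app t v) e =
    trans (subC-°[] σ t (push (v •) e)) (cong (λ w → subT σ t °[ push w (subE (σ •ˢ) e) ]) (subSV-• σ v))
  subC-°[] σ (es t u)  e = trans (subC-°[] σ u _) (cong (λ c → subT σ u °[ mut c ]) (begin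
    subC (sexts (σ •ˢ)) (t °[ renE suc e ])        ≡⟨ subC-cong (sexts-• σ) (t °[ renE suc e ]) ⟩
    subC (exts σ •ˢ) (t °[ renE suc e ])           ≡⟨ subC-°[] (exts σ) t (renE suc e) ⟩
    subT (exts σ) t °[ subE (exts σ •ˢ) (renE suc e) ]
      ≡⟨ cong (subT (exts σ) t °[_]) (sym (subE-cong (sexts-• σ) (renE suc e))) ⟩
    subT (exts σ) t °[ subE (sexts (σ •ˢ)) (renE suc e) ]
      ≡⟨ cong (subT (exts σ) t °[_]) (subE-sexts-suc (σ •ˢ) e) ⟩
    subT (exts σ) t °[ renE suc (subE (σ •ˢ) e) ]  ∎))
    where open ≡-Reasoning

  subSV-• : ∀ {n m} (σ : Sub n m) v → subSV (σ •ˢ) (v •) ≡ subV σ v •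
  subSV-• σ (var i) = refl
  subSV-• σ (lam t) = cong slam (begin
    subC (sexts (σ •ˢ)) (t °)          ≡⟨ subC-cong (sexts-• σ) (t °) ⟩
    subC (exts σ •ˢ) (t °)             ≡⟨ cong (subC (exts σ •ˢ)) (°-as-acc t) ⟩
    subC (exts σ •ˢ) (t °[ ε ])        ≡⟨ subC-°[] (exts σ) t ε ⟩
    subT (exts σ) t °[ ε ]             ≡⟨ sym (°-as-acc (subT (exts σ) t)) ⟩
    subT (exts σ) t °                  ∎)
    where open ≡-Reasoning

mutual
  subC-step : ∀ {n m k} {c c' : Cmd n} (σ : SSub n m) → k ⊢ c ⟶s c' → k ⊢ subC σ c ⟶s subC σ c'
  subC-step σ (root-λ̄ c v e) =
    subst₂ (λ̄-step ⊢_⟶s_) refl (cong (cut (subSV σ v)) (sym (subE-++ σ (mut c) e)))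
      (root-λ̄ (subC (sexts σ) c) (subSV σ v) (subE σ e))
  subC-step σ (root-μ̃ v c) =
    subst₂ (μ̃-step ⊢_⟶s_) refl (sym (subC-single σ v c)) (root-μ̃ (subSV σ v) (subC (sexts σ) c))
  subC-step σ (ctx-cut v r) = ctx-cut (subSV σ v) (subE-step σ r)

  subE-step : ∀ {n m k} {e e' : Env n} (σ : SSub n m) → k ⊢ e ⟶se e' → k ⊢ subE σ e ⟶se subE σ e'
  subE-step σ (ctx-push v r) = ctx-push (subSV σ v) (subE-step σ r)
  subE-step σ (ctx-mut r)    = ctx-mut (subC-step (sexts σ) r)

renE-step : ∀ {n m k} {e e' : Env n} (ρ : Ren n m) → k ⊢ e ⟶se e' → k ⊢ renE ρ e ⟶se renE ρ e'
renE-step {k = k} {e} {e'} ρ r =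
  subst₂ (k ⊢_⟶se_) (sym (renE-as-sub ρ e)) (sym (renE-as-sub ρ e')) (subE-step _ r)

mutual
  ++c-step : ∀ {n k} (c : Cmd n) {e e'} → k ⊢ e ⟶se e' → k ⊢ (c ++c e) ⟶s (c ++c e')
  ++c-step (cut v f) r = ctx-cut v (++e-step f r)

  ++e-step : ∀ {n k} (f : Env n) {e e'} → k ⊢ e ⟶se e' → k ⊢ (f ++e e) ⟶se (f ++e e')
  ++e-step ε          r = r
  ++e-step (push w f) r = ctx-push w (++e-step f r)
  ++e-step (mut c)    r = ctx-mut (++c-step c (renE-step suc r))

°[]-step : ∀ {n k} (t : Tm n) {e e'} → k ⊢ e ⟶se e' → k ⊢ t °[ e ] ⟶s t °[ e' ]
°[]-step (val v)   r = ctx-cut (v •) r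
°[]-step (app t v) r = °[]-step t (ctx-push (v •) r)
°[]-step (es t u)  r = °[]-step u (ctx-mut (°[]-step t (renE-step suc r)))

κ : VKind → SKind
κ m-step = λ̄-step
κ e-step = μ̃-step

simulate-m : ∀ {n m} (L : SCtx n m) (t : Tm (suc m)) (v : Val n) e →
  λ̄-step ⊢ plugL L (val (lam t)) °[ push (v •) e ] ⟶s plugL L (es t (val (renV (wkL L) v))) °[ e ]
simulate-m hole t v e =
  subst₂ (λ̄-step ⊢_⟶s_) refl
    (cong₂ (λ w c → cut w (mut c)) (cong _• (sym (renV-id (λ _ → refl) v))) (°-++ t (renE suc e)))
    (root-λ̄ (t °) (v •) e)
simulate-m (esc L u) t v e = °[]-step u (ctx-mut
  (subst₂ (λ̄-step ⊢_⟶s_)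
    (cong (λ w → plugL L (val (lam t)) °[ push w (renE suc e) ]) (sym (renSV-• suc v)))
    (cong (λ w → plugL L (es t (val w)) °[ renE suc e ]) (renV-renV (wkL L) suc v))
    (simulate-m L t (renV suc v) (renE suc e))))

simulate-e : ∀ {n m} (t : Tm (suc n)) (L : SCtx n m) (v : Val m) e →
  μ̃-step ⊢ es t (plugL L (val v)) °[ e ] ⟶s plugL L (renT (ext (wkL L)) t ⟨0≔ v ⟩) °[ e ]
simulate-e t hole v e =
  subst₂ (μ̃-step ⊢_⟶s_) refl contractum (root-μ̃ (v •) (t °[ renE suc e ]))
  where
  ssingle-• : ssingle (v •) ≗ (single v •ˢ)
  ssingle-• zero    = refl
  ssingle-• (suc i) = refl
  contractum : subC (ssingle (v •)) (t °[ renE suc e ]) ≡ (renT (ext (λ i → i)) t ⟨0≔ v ⟩) °[ e ]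
  contractum = begin
    subC (ssingle (v •)) (t °[ renE suc e ])          ≡⟨ subC-cong ssingle-• _ ⟩
    subC (single v •ˢ) (t °[ renE suc e ])            ≡⟨ subC-°[] (single v) t (renE suc e) ⟩
    (t ⟨0≔ v ⟩) °[ subE (single v •ˢ) (renE suc e) ]
      ≡⟨ cong₂ _°[_] (cong (subT (single v)) (sym (renT-id (ext-id (λ _ → refl)) t)))
                     (trans (subE-renE (single v •ˢ) suc e) (subE-id (λ _ → refl) e)) ⟩
    (renT (ext (λ i → i)) t ⟨0≔ v ⟩) °[ e ]             ∎
    where open ≡-Reasoning
simulate-e t (esc L u) v e = °[]-step u (ctx-mut
  (subst₂ (μ̃-step ⊢_⟶s_)
    (cong (λ c → plugL L (val v) °[ mut c ])
      (sym (trans (renC-°[] (ext suc) t (renE suc e)) (cong (renT (ext suc) t °[_]) (renE-ext-suc suc e)))))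
    (cong (λ s → plugL L (s ⟨0≔ v ⟩) °[ renE suc e ])
      (trans (renT-renT (ext (wkL L)) (ext suc) t) (renT-cong ext-wk t)))
    (simulate-e (renT (ext suc) t) L v (renE suc e))))
  where
  ext-wk : (λ i → ext (wkL L) (ext suc i)) ≗ ext (wkL (esc L u))
  ext-wk zero    = refl
  ext-wk (suc i) = refl

simulate-acc : ∀ {n k} {t u : Tm n} → k ⊢ t ⟶v u → ∀ e → κ k ⊢ t °[ e ] ⟶s u °[ e ]
simulate-acc (root-m L t v) e = simulate-m L t v e
simulate-acc (root-e t L v) e = simulate-e t L v e
simulate-acc (ctx-app v r)  e = simulate-acc r (push (v •) e)
simulate-acc (ctx-esl u r)  e = °[]-step u (ctx-mut (simulate-acc r (renE suc e)))
simulate-acc (ctx-esr t r)  e = simulate-acc r (mut (t °[ renE suc e ]))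

simulate : ∀ {n k} {t u : Tm n} → k ⊢ t ⟶v u → κ k ⊢ (t °) ⟶s (u °)
simulate {k = k} {t} {u} r =
  subst₂ (κ k ⊢_⟶s_) (sym (°-as-acc t)) (sym (°-as-acc u)) (simulate-acc r ε)

data EndsInApp : ∀ {n} → Tm n → Set where
  app-end : ∀ {n} {t : Tm n} {v} → EndsInApp (app t v)
  es-end  : ∀ {n} {t : Tm (suc n)} {u} → EndsInApp t → EndsInApp (es t u)

data EndsInNonLam : ∀ {n} → Tm n → Set where
  var-end : ∀ {n} {x : Fin n} → EndsInNonLam (val (var x))
  app-end : ∀ {n} {t : Tm n} {v} → EndsInNonLam (app t v)
  es-end  : ∀ {n} {t : Tm (suc n)} {u} → EndsInNonLam t → EndsInNonLam (es t u)

data NF : ∀ {n} → Tm n → Set where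
  nf-val : ∀ {n} {v : Val n} → NF (val v)
  nf-app : ∀ {n} {t : Tm n} {v} → NF t → EndsInNonLam t → NF (app t v)
  nf-es  : ∀ {n} {t : Tm (suc n)} {u} → NF t → NF u → EndsInApp u → NF (es t u)

endsInApp? : ∀ {n} (u : Tm n) →
  EndsInApp u ⊎ Σ[ m ∈ ℕ ] Σ[ L ∈ SCtx n m ] Σ[ v ∈ Val m ] u ≡ plugL L (val v)
endsInApp? (val v)   = inj₂ (_ , hole , v , refl)
endsInApp? (app t v) = inj₁ app-end
endsInApp? (es t u) with endsInApp? t
... | inj₁ t-app              = inj₁ (es-end t-app)
... | inj₂ (m , L , v , refl) = inj₂ (m , esc L u , v , refl)

endsInNonLam? : ∀ {n} (t : Tm n) →
  EndsInNonLam t ⊎ Σ[ m ∈ ℕ ] Σ[ L ∈ SCtx n m ] Σ[ s ∈ Tm (suc m) ] t ≡ plugL L (val (lam s))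
endsInNonLam? (val (var x)) = inj₁ var-end
endsInNonLam? (val (lam s)) = inj₂ (_ , hole , s , refl)
endsInNonLam? (app t v)     = inj₁ app-end
endsInNonLam? (es t u) with endsInNonLam? t
... | inj₁ t-nonlam           = inj₁ (es-end t-nonlam)
... | inj₂ (m , L , s , refl) = inj₂ (m , esc L u , s , refl)

answer-not-app : ∀ {n m} (L : SCtx n m) {v} → EndsInApp (plugL L (val v)) → ⊥
answer-not-app hole      ()
answer-not-app (esc L u) (es-end h) = answer-not-app L h

lam-answer-not-nonlam : ∀ {n m} (L : SCtx n m) {s} → EndsInNonLam (plugL L (val (lam s))) → ⊥
lam-answer-not-nonlam hole      ()
lam-answer-not-nonlam (esc L u) (es-end h) = lam-answer-not-nonlam L h

nf-normal : ∀ {n} {t : Tm n} → NF t → Normal VStep t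
nf-normal (nf-app _ t-nonlam)   (_ , _ , root-m L _ _) = lam-answer-not-nonlam L t-nonlam
nf-normal (nf-app t-nf _)       (_ , _ , ctx-app _ r)  = nf-normal t-nf (_ , _ , r)
nf-normal (nf-es _ _ u-app)     (_ , _ , root-e _ L _) = answer-not-app L u-app
nf-normal (nf-es t-nf _ _)      (_ , _ , ctx-esl _ r)  = nf-normal t-nf (_ , _ , r)
nf-normal (nf-es _ u-nf _)      (_ , _ , ctx-esr _ r)  = nf-normal u-nf (_ , _ , r)

Reducible : ∀ {n} → Tm n → Set
Reducible {n} t = Σ[ k ∈ VKind ] Σ[ u ∈ Tm n ] k ⊢ t ⟶v u

progress : ∀ {n} (t : Tm n) → NF t ⊎ Reducible t
progress (val v) = inj₁ nf-val
progress (app t v) with progress t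
... | inj₂ (k , t' , r) = inj₂ (k , app t' v , ctx-app v r)
... | inj₁ t-nf with endsInNonLam? t
...   | inj₁ t-nonlam           = inj₁ (nf-app t-nf t-nonlam)
...   | inj₂ (m , L , s , refl) = inj₂ (m-step , _ , root-m L s v)
progress (es t u) with progress t | progress u
... | inj₂ (k , t' , r) | _                 = inj₂ (k , es t' u , ctx-esl u r)
... | inj₁ _            | inj₂ (k , u' , r) = inj₂ (k , es t u' , ctx-esr t r)
... | inj₁ t-nf         | inj₁ u-nf with endsInApp? u
...   | inj₁ u-app              = inj₁ (nf-es t-nf u-nf u-app)
...   | inj₂ (m , L , v , refl) = inj₂ (e-step , _ , root-e t L v)

normal⇒nf : ∀ {n} (t : Tm n) → Normal VStep t → NF t
normal⇒nf t t-normal with progress t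
... | inj₁ t-nf = t-nf
... | inj₂ r    = ⊥-elim (t-normal r)

-- Normal forms of vseq: no cut ⟨λx.c | v·e⟩ or ⟨v | μ̃x.c⟩ in a position
-- reachable by the contexts C (which never go under an abstraction).

NoRedex : ∀ {n} → SVal n → Env n → Set
NoRedex v        ε          = ⊤
NoRedex v        (mut _)    = ⊥
NoRedex (svar _) (push _ _) = ⊤
NoRedex (slam _) (push _ _) = ⊥

mutual
  NFc : ∀ {n} → Cmd n → Set
  NFc (cut v e) = NoRedex v e × NFe e

  NFe : ∀ {n} → Env n → Set
  NFe ε          = ⊤
  NFe (mut c)    = NFc c
  NFe (push _ e) = NFe e

mutual
  nfc-normal : ∀ {n} {c : Cmd n} → NFc c → Normal SStep c
  nfc-normal (() , _)      (_ , _ , root-λ̄ _ _ _)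
  nfc-normal (() , _)      (_ , _ , root-μ̃ _ _)
  nfc-normal (_ , e-nf)    (_ , _ , ctx-cut _ r) = nfe-normal e-nf r

  nfe-normal : ∀ {n k} {e e' : Env n} → NFe e → k ⊢ e ⟶se e' → ⊥
  nfe-normal e-nf (ctx-push _ r) = nfe-normal e-nf r
  nfe-normal c-nf (ctx-mut r)    = nfc-normal c-nf (_ , _ , r)

-- Normality is stable under renaming (needed for the weakened environments
-- of explicit substitutions).
noRedex-ren : ∀ {n m} (ρ : Ren n m) v e → NoRedex v e → NoRedex (renSV ρ v) (renE ρ e)
noRedex-ren ρ v        ε          _ = tt
noRedex-ren ρ (svar _) (push _ _) _ = tt

mutual
  nfc-ren : ∀ {n m} (ρ : Ren n m) c → NFc c → NFc (renC ρ c)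
  nfc-ren ρ (cut v e) (no-redex , e-nf) = noRedex-ren ρ v e no-redex , nfe-ren ρ e e-nf

  nfe-ren : ∀ {n m} (ρ : Ren n m) e → NFe e → NFe (renE ρ e)
  nfe-ren ρ ε          _    = tt
  nfe-ren ρ (mut c)    c-nf = nfc-ren (ext ρ) c c-nf
  nfe-ren ρ (push v e) e-nf = nfe-ren ρ e e-nf

-- Fact (2).  `Fits t e`: the value that t ends in forms no redex with the
-- environment e (weakened past the explicit substitutions of t).
Fits : ∀ {n} → Tm n → Env n → Set
Fits (val v)   e = NoRedex (v •) e
Fits (app t v) e = ⊤
Fits (es t u)  e = Fits t (renE suc e)

fits-ε : ∀ {n} (t : Tm n) → Fits t ε
fits-ε (val v)   = tt
fits-ε (app t v) = tt
fits-ε (es t u)  = fits-ε t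

nonLam-fits-push : ∀ {n} {t : Tm n} {w e} → EndsInNonLam t → Fits t (push w e)
nonLam-fits-push var-end    = tt
nonLam-fits-push app-end    = tt
nonLam-fits-push (es-end h) = nonLam-fits-push h

app-fits-mut : ∀ {n} {u : Tm n} {c} → EndsInApp u → Fits u (mut c)
app-fits-mut app-end    = tt
app-fits-mut (es-end h) = app-fits-mut h

nf-°[] : ∀ {n} {t : Tm n} {e} → NF t → NFe e → Fits t e → NFc (t °[ e ])
nf-°[]         nf-val                     e-nf fits = fits , e-nf
nf-°[]         (nf-app t-nf t-nonlam)     e-nf _    = nf-°[] t-nf e-nf (nonLam-fits-push t-nonlam)
nf-°[] {e = e} (nf-es t-nf u-nf u-app)    e-nf fits =
  nf-°[] u-nf (nf-°[] t-nf (nfe-ren suc e e-nf) fits) (app-fits-mut u-app)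

preserve-normal : ∀ {n} {t : Tm n} → Normal VStep t → Normal SStep (t °)
preserve-normal {t = t} t-normal rewrite °-as-acc t =
  nfc-normal (nf-°[] (normal⇒nf t t-normal) tt (fits-ε t))

-- Reduction is closed under the
-- contexts C only, so two distinct steps are either both at the root (hence
-- equal) or one is at the root and the other inside its environment.
mutual
  diamondC : ∀ {n} → Diamond (SStep {n})
  diamondC (root-λ̄ c v e) (root-λ̄ .c .v .e) = inj₁ (refl , refl)
  diamondC (root-λ̄ c v e) (ctx-cut .(slam c) (ctx-push .v r)) =
    inj₂ (_ , ctx-cut v (++e-step (mut c) r) , root-λ̄ c v _)
  diamondC (root-μ̃ v c) (root-μ̃ .v .c) = inj₁ (refl , refl)
  diamondC (root-μ̃ v c) (ctx-cut .v (ctx-mut r)) =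
    inj₂ (_ , subC-step (ssingle v) r , root-μ̃ v _)
  diamondC (ctx-cut .(slam c) (ctx-push .v r)) (root-λ̄ c v e) =
    inj₂ (_ , root-λ̄ c v _ , ctx-cut v (++e-step (mut c) r))
  diamondC (ctx-cut .v (ctx-mut r)) (root-μ̃ v c) =
    inj₂ (_ , root-μ̃ v _ , subC-step (ssingle v) r)
  diamondC (ctx-cut v r₁) (ctx-cut .v r₂) with diamondE r₁ r₂
  ... | inj₁ (refl , refl)   = inj₁ (refl , refl)
  ... | inj₂ (d , s₁ , s₂)   = inj₂ (cut v d , ctx-cut v s₁ , ctx-cut v s₂)

  diamondE : ∀ {n} → Diamond (λ k (e e' : Env n) → k ⊢ e ⟶se e')
  diamondE (ctx-push v r₁) (ctx-push .v r₂) with diamondE r₁ r₂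
  ... | inj₁ (refl , refl)   = inj₁ (refl , refl)
  ... | inj₂ (d , s₁ , s₂)   = inj₂ (push v d , ctx-push v s₁ , ctx-push v s₂)
  diamondE (ctx-mut r₁) (ctx-mut r₂) with diamondC r₁ r₂
  ... | inj₁ (refl , refl)   = inj₁ (refl , refl)
  ... | inj₂ (d , s₁ , s₂)   = inj₂ (mut d , ctx-mut s₁ , ctx-mut s₂)

isE≡isμ̃∘κ : ∀ k → isE k ≡ isμ̃ (κ k)
isE≡isμ̃∘κ m-step = refl
isE≡isμ̃∘κ e-step = refl

isM≡isλ̄∘κ : ∀ k → isM k ≡ isλ̄ (κ k)
isM≡isλ̄∘κ m-step = refl
isM≡isλ̄∘κ e-step = refl

corollary5 : ∀ {n} (t : Tm n) →
    ((NormDeriv VStep t → NormDeriv SStep (t °)) × (NormDeriv SStep (t °) → NormDeriv VStep t))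
    × (∀ (d : NormDeriv VStep t) (e : NormDeriv SStep (t °)) →
         ndLen d ≡ ndLen e × ndCount isE d ≡ ndCount isμ̃ e × ndCount isM d ≡ ndCount isλ̄ e)
corollary5 {n} t = (forward , backward) , measures
  where
  reducible? : ∀ (u : Tm n) → Normal VStep u ⊎ Reducible u
  reducible? u with progress u
  ... | inj₁ u-nf = inj₁ (nf-normal u-nf)
  ... | inj₂ r    = inj₂ r

  open Simulation _° κ simulate preserve-normal reducible? diamondC

  measures : ∀ (d : NormDeriv VStep t) (e : NormDeriv SStep (t °)) →
    ndLen d ≡ ndLen e × ndCount isE d ≡ ndCount isμ̃ e × ndCount isM d ≡ ndCount isλ̄ e
  measures d e with same-measures d e
  ... | len-eq , count-eq = len-eq , count-eq isE isμ̃ isE≡isμ̃∘κ , count-eq isM isλ̄ isM≡isλ̄∘κ
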